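{- Let $\lambda$ be a nonzero real number. For all integers $m,n\ge 0$, $$F_{n+m,\lambda}(t)=\sum_{k=0}^{m}\sum_{l=0}^{n}k!\,{m \brace k}_{\lambda}\binom{n}{l}t^{k}\,F_{n-l,\lambda}^{(k)}(t,k-m\lambda)\,F_{l,\lambda}(t).$$
   Context: For nonzero real $\lambda$, the degenerate falling factorial is $(x)_{0,\lambda}=1$, $(x)_{n,\lambda}=x(x-\lambda)\cdots(x-(n-1)\lambda)$ for $n\ge1$, and the degenerate exponential is $e_{\lambda}^{x}(s)=(1+\lambda s)^{x/\lambda}=\sum_{k\ge0}(x)_{k,\lambda}\frac{s^k}{k!}$, with $e_\lambda(s)=e_\lambda^1(s)$. The degenerate Stirling numbers of the second kind ${n \brace k}_{\lambda}$ are defined by $\frac{1}{k!}(e_{\lambda}(s)-1)^{k}=\sum_{n\ge k}{n \brace k}_{\lambda}\frac{s^{n}}{n!}$ for $k\ge0$. The degenerate Fubini polynomials are $F_{n,\lambda}(x)=\sum_{k=0}^{n}k!{n \brace k}_{\lambda}x^{k}$, equivalently $\frac{1}{1-x(e_{\lambda}(s)-1)}=\sum_{n\ge0}F_{n,\lambda}(x)\frac{s^n}{n!}$. The two-variable degenerate Fubini polynomials of order $\alpha$ are defined by $\Big(\frac{1}{1-x(e_{\lambda}(s)-1)}\Big)^{\alpha}e_{\lambda}^{y}(s)=\sum_{n\ge0}F_{n,\lambda}^{(\alpha)}(x,y)\frac{s^{n}}{n!}$.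
   Formalization: The parameter λ is a nonzero rational instead of a nonzero real, and the variable t is rational as well. -}

module Defs where

open import Data.Nat as ℕ using (ℕ; zero; suc; _∸_; _!)
open import Data.Nat.Properties using (_!≢0)
open import Data.Nat.Combinatorics using (_C_)
open import Data.Integer using (+_)
open import Data.Rational using (ℚ; 0ℚ; 1ℚ; _+_; _*_; _-_; _/_)

ofℕ : ℕ → ℚ
ofℕ n = + n / 1

inv! : ℕ → ℚ
inv! n = (+ 1 / (n !)) {{n !≢0}}

_^ℚ_ : ℚ → ℕ → ℚ
x ^ℚ zero  = 1ℚ
x ^ℚ suc k = x * (x ^ℚ k)

sumTo : ℕ → (ℕ → ℚ) → ℚ
sumTo zero    f = f 0
sumTo (suc n) f = sumTo n f + f (suc n)

-- formal power series in s over ℚ, given by ordinary coefficients: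
-- a represents  Σ_n a n · s^n
Series : Set
Series = ℕ → ℚ

_⊛_ : Series → Series → Series
(a ⊛ b) n = sumTo n (λ i → a i * b (n ∸ i))

oneS : Series
oneS zero    = 1ℚ
oneS (suc _) = 0ℚ

powS : Series → ℕ → Series
powS a zero    = oneS
powS a (suc k) = a ⊛ powS a k

scaleS : ℚ → Series → Series
scaleS c a n = c * a n

minusOneS : Series → Series
minusOneS a zero    = a 0 - 1ℚ
minusOneS a (suc n) = a (suc n)

-- 1 / (1 - u)  =  Σ_{j ≥ 0} u^j, for a series u with zero constant term
-- (then u^j has no s^n-term for j > n, so the coefficient of s^n is a finite sum)
geomS : Series → Series
geomS u n = sumTo n (λ j → powS u j n)

fallingλ : ℚ → ℚ → ℕ → ℚ
fallingλ lam x zero    = 1ℚ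
fallingλ lam x (suc n) = fallingλ lam x n * (x - ofℕ n * lam)

eλ^ : ℚ → ℚ → Series
eλ^ lam x k = fallingλ lam x k * inv! k

eλ : ℚ → Series
eλ lam = eλ^ lam 1ℚ

-- degenerate Stirling numbers of the second kind:
-- (1/k!)(e_λ(s) - 1)^k = Σ_n S_λ(n,k) s^n / n!
stirling2λ : ℚ → ℕ → ℕ → ℚ
stirling2λ lam n k = ofℕ (n !) * (inv! k * powS (minusOneS (eλ lam)) k n)

fubiniλ : ℚ → ℕ → ℚ → ℚ
fubiniλ lam n x = sumTo n (λ k → ofℕ (k !) * stirling2λ lam n k * (x ^ℚ k))

-- two-variable degenerate Fubini polynomials of order α (α ∈ ℕ):
-- (1/(1 - x(e_λ(s) - 1)))^α e_λ^y(s) = Σ_n F^{(α)}_{n,λ}(x,y) s^n / n!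
fubini2λ : ℚ → ℕ → ℕ → ℚ → ℚ → ℚ
fubini2λ lam α n x y =
  ofℕ (n !) * ((powS (geomS (scaleS x (minusOneS (eλ lam)))) α ⊛ eλ^ lam y) n)

{-# OPTIONS --safe #-}
-- Work with ordinary coefficients in s and the derivative ∂. With u = e_λ(s) − 1 and
-- G = 1/(1 − t u) we have F_{N,λ}(t) = N! [s^N] G, so F_{n+m,λ}(t) = n! [s^n] ∂^m G.
-- The rules ∂ e_λ^x = x e_λ^{x−λ}, e_λ^a e_λ^b = e_λ^{a+b} and ∂ G = t e_λ^{1−λ} G² give
--   ∂^m G = Σ_k k! S_λ(m,k) t^k G^{k+1} e_λ^{k−mλ}
-- by induction on m: differentiating produces the terms of index k+1 and k, and they regroup by
-- the recurrence for k! S_λ(m,k), read off from the s^m-coefficient of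
-- e_λ^λ ∂(u^{k+1}) = (k+1)(u^k + u^{k+1}), where e_λ^λ(s) = 1 + λs. Finally n! [s^n] of
-- G · (G^k e_λ^{k−mλ}) is a binomial convolution of F_{l,λ}(t) and F^{(k)}_{n−l,λ}(t, k − mλ).
module Submission where

open import Defs
open import Data.Nat as ℕ using (ℕ; zero; suc; _∸_; _!; z≤n; s≤s)
import Data.Nat
import Data.Nat.Properties as ℕ
open import Data.Nat.Combinatorics using (_C_; nCk≡n!/k![n-k]!; k![n∸k]!∣n!)
open import Data.Nat.DivMod using (m/n*n≡m)
open import Data.Nat.Coprimality using (1-coprimeTo) renaming (sym to coprime-sym)
import Data.Integer as ℤ
import Data.Integer.Properties as ℤ
open import Data.Rational using (ℚ; 0ℚ; 1ℚ; _+_; _*_; _-_; -_; _/_; mkℚ; toℚᵘ)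
import Data.Rational.Unnormalised as ℚᵘ
import Data.Rational.Unnormalised.Properties as ℚᵘ
open import Data.Rational.Properties
open import Data.Rational.Solver using (module +-*-Solver)
open import Data.Product using (_,_)
open import Function using (_∘_)
open import Level using (0ℓ)
open import Data.Sum using (inj₁; inj₂)
open import Algebra.Bundles using (CommutativeSemiring)
import Algebra.Solver.Ring.NaturalCoefficients.Default as SemiringSolver
open import Relation.Binary.PropositionalEquality

toℚᵘ-ofℕ : ∀ n → toℚᵘ (ofℕ n) ℚᵘ.≃ ℚᵘ.mkℚᵘ (ℤ.+ n) 0
toℚᵘ-ofℕ n = toℚᵘ-fromℚᵘ (ℚᵘ.mkℚᵘ (ℤ.+ n) 0)

ofℕ-+ : ∀ a b → ofℕ (a ℕ.+ b) ≡ ofℕ a + ofℕ b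
ofℕ-+ a b = toℚᵘ-injective (begin-equality
  toℚᵘ (ofℕ (a ℕ.+ b))                        ≃⟨ toℚᵘ-ofℕ (a ℕ.+ b) ⟩
  ℚᵘ.mkℚᵘ (ℤ.+ (a ℕ.+ b)) 0                   ≃⟨ ℚᵘ.*≡* (cong (ℤ._* ℤ.+ 1) numerators) ⟩
  ℚᵘ.mkℚᵘ (ℤ.+ a) 0 ℚᵘ.+ ℚᵘ.mkℚᵘ (ℤ.+ b) 0    ≃⟨ ℚᵘ.+-cong (toℚᵘ-ofℕ a) (toℚᵘ-ofℕ b) ⟨
  toℚᵘ (ofℕ a) ℚᵘ.+ toℚᵘ (ofℕ b)              ≃⟨ toℚᵘ-homo-+ (ofℕ a) (ofℕ b) ⟨
  toℚᵘ (ofℕ a + ofℕ b)                        ∎)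
  where
  open ℚᵘ.≤-Reasoning
  numerators : ℤ.+ (a ℕ.+ b) ≡ ℤ.+ a ℤ.* ℤ.+ 1 ℤ.+ ℤ.+ b ℤ.* ℤ.+ 1
  numerators = trans (ℤ.pos-+ a b) (sym (cong₂ ℤ._+_ (ℤ.*-identityʳ (ℤ.+ a)) (ℤ.*-identityʳ (ℤ.+ b))))

ofℕ-* : ∀ a b → ofℕ (a ℕ.* b) ≡ ofℕ a * ofℕ b
ofℕ-* a b = toℚᵘ-injective (begin-equality
  toℚᵘ (ofℕ (a ℕ.* b))                        ≃⟨ toℚᵘ-ofℕ (a ℕ.* b) ⟩
  ℚᵘ.mkℚᵘ (ℤ.+ (a ℕ.* b)) 0                   ≃⟨ ℚᵘ.*≡* (cong (ℤ._* ℤ.+ 1) (ℤ.pos-* a b)) ⟩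
  ℚᵘ.mkℚᵘ (ℤ.+ a) 0 ℚᵘ.* ℚᵘ.mkℚᵘ (ℤ.+ b) 0    ≃⟨ ℚᵘ.*-cong (toℚᵘ-ofℕ a) (toℚᵘ-ofℕ b) ⟨
  toℚᵘ (ofℕ a) ℚᵘ.* toℚᵘ (ofℕ b)              ≃⟨ toℚᵘ-homo-* (ofℕ a) (ofℕ b) ⟨
  toℚᵘ (ofℕ a * ofℕ b)                        ∎)
  where open ℚᵘ.≤-Reasoning

open ≡-Reasoning

ofℕ-suc : ∀ n → ofℕ (suc n) ≡ 1ℚ + ofℕ n
ofℕ-suc = ofℕ-+ 1

ofℕ-*-inverse : ∀ d .{{_ : ℕ.NonZero d}} → ofℕ d * (ℤ.+ 1 / d) ≡ 1ℚ
ofℕ-*-inverse (suc d) =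
  trans (cong₂ _*_ (normalize-coprime d⊥1) (normalize-coprime (1-coprimeTo (suc d))))
        (*-inverseʳ (mkℚ (ℤ.+ suc d) 0 d⊥1))
  where d⊥1 = coprime-sym (1-coprimeTo (suc d))

ofℕ-!-inv! : ∀ n → ofℕ (n !) * inv! n ≡ 1ℚ
ofℕ-!-inv! n = ofℕ-*-inverse (n !) {{n ℕ.!≢0}}

*-cancelˡ-invertible : ∀ {a b x y} → b * a ≡ 1ℚ → a * x ≡ a * y → x ≡ y
*-cancelˡ-invertible {a} {b} {x} {y} ba≡1 ax≡ay = begin
  x             ≡⟨ *-identityˡ x ⟨
  1ℚ * x        ≡⟨ cong (_* x) ba≡1 ⟨
  b * a * x     ≡⟨ *-assoc b a x ⟩
  b * (a * x)   ≡⟨ cong (b *_) ax≡ay ⟩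
  b * (a * y)   ≡⟨ *-assoc b a y ⟨
  b * a * y     ≡⟨ cong (_* y) ba≡1 ⟩
  1ℚ * y        ≡⟨ *-identityˡ y ⟩
  y             ∎

ofℕ-suc-cancelˡ : ∀ n {x y} → ofℕ (suc n) * x ≡ ofℕ (suc n) * y → x ≡ y
ofℕ-suc-cancelˡ n = *-cancelˡ-invertible {ofℕ (suc n)} {ℤ.+ 1 / suc n}
  (trans (*-comm (ℤ.+ 1 / suc n) (ofℕ (suc n))) (ofℕ-*-inverse (suc n)))

inv!-suc : ∀ n → ofℕ (suc n) * inv! (suc n) ≡ inv! n
inv!-suc n = *-cancelˡ-invertible {ofℕ (n !)} {inv! n} (trans (*-comm (inv! n) (ofℕ (n !))) (ofℕ-!-inv! n)) (begin
  ofℕ (n !) * (ofℕ (suc n) * inv! (suc n))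
    ≡⟨ *-assoc (ofℕ (n !)) _ _ ⟨
  ofℕ (n !) * ofℕ (suc n) * inv! (suc n)
    ≡⟨ cong (_* inv! (suc n)) (trans (ofℕ-* (suc n) (n !)) (*-comm (ofℕ (suc n)) (ofℕ (n !)))) ⟨
  ofℕ (suc n !) * inv! (suc n)
    ≡⟨ ofℕ-!-inv! (suc n) ⟩
  1ℚ
    ≡⟨ ofℕ-!-inv! n ⟨
  ofℕ (n !) * inv! n ∎)

ofℕ-binomial : ∀ {n l} → l ℕ.≤ n → ofℕ (n C l) * (ofℕ (l !) * ofℕ ((n ∸ l) !)) ≡ ofℕ (n !)
ofℕ-binomial {n} {l} l≤n = begin
  ofℕ (n C l) * (ofℕ (l !) * ofℕ ((n ∸ l) !))   ≡⟨ cong (ofℕ (n C l) *_) (ofℕ-* (l !) ((n ∸ l) !)) ⟨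
  ofℕ (n C l) * ofℕ (l ! ℕ.* (n ∸ l) !)         ≡⟨ ofℕ-* (n C l) _ ⟨
  ofℕ ((n C l) ℕ.* (l ! ℕ.* (n ∸ l) !))         ≡⟨ cong ofℕ n!-factors ⟩
  ofℕ (n !)                                     ∎
  where
  n!-factors : (n C l) ℕ.* (l ! ℕ.* (n ∸ l) !) ≡ n !
  n!-factors = trans (cong (ℕ._* (l ! ℕ.* (n ∸ l) !)) (nCk≡n!/k![n-k]! l≤n))
                     (m/n*n≡m {{ℕ._!*_!≢0 l (n ∸ l)}} (k![n∸k]!∣n! l≤n))

sumTo-cong : ∀ n {f g : ℕ → ℚ} → (∀ i → f i ≡ g i) → sumTo n f ≡ sumTo n g
sumTo-cong zero    f≗g = f≗g 0
sumTo-cong (suc n) f≗g = cong₂ _+_ (sumTo-cong n f≗g) (f≗g (suc n))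

sumTo-cong-≤ : ∀ n {f g : ℕ → ℚ} → (∀ {i} → i ℕ.≤ n → f i ≡ g i) → sumTo n f ≡ sumTo n g
sumTo-cong-≤ zero    f≗g = f≗g z≤n
sumTo-cong-≤ (suc n) f≗g = cong₂ _+_ (sumTo-cong-≤ n (f≗g ∘ ℕ.m≤n⇒m≤1+n)) (f≗g ℕ.≤-refl)

sumTo-zero : ∀ n {f : ℕ → ℚ} → (∀ {i} → i ℕ.≤ n → f i ≡ 0ℚ) → sumTo n f ≡ 0ℚ
sumTo-zero zero    f≗0 = f≗0 z≤n
sumTo-zero (suc n) f≗0 = cong₂ _+_ (sumTo-zero n (f≗0 ∘ ℕ.m≤n⇒m≤1+n)) (f≗0 ℕ.≤-refl)

sumTo-+ : ∀ n (f g : ℕ → ℚ) → sumTo n (λ i → f i + g i) ≡ sumTo n f + sumTo n g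
sumTo-+ zero    f g = refl
sumTo-+ (suc n) f g = begin
  sumTo n (λ i → f i + g i) + (f (suc n) + g (suc n))  ≡⟨ cong (_+ (f (suc n) + g (suc n))) (sumTo-+ n f g) ⟩
  (sumTo n f + sumTo n g) + (f (suc n) + g (suc n))    ≡⟨ interchange (sumTo n f) (sumTo n g) (f (suc n)) (g (suc n)) ⟩
  sumTo (suc n) f + sumTo (suc n) g                    ∎
  where
  open +-*-Solver
  interchange : ∀ a b c d → (a + b) + (c + d) ≡ (a + c) + (b + d)
  interchange = solve 4 (λ a b c d → (a :+ b) :+ (c :+ d) := (a :+ c) :+ (b :+ d)) refl

sumTo-*ˡ : ∀ n c (f : ℕ → ℚ) → c * sumTo n f ≡ sumTo n (λ i → c * f i)
sumTo-*ˡ zero    c f = refl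
sumTo-*ˡ (suc n) c f = trans (*-distribˡ-+ c (sumTo n f) (f (suc n))) (cong (_+ c * f (suc n)) (sumTo-*ˡ n c f))

sumTo-*ʳ : ∀ n c (f : ℕ → ℚ) → sumTo n f * c ≡ sumTo n (λ i → f i * c)
sumTo-*ʳ n c f = trans (*-comm (sumTo n f) c) (trans (sumTo-*ˡ n c f) (sumTo-cong n (λ i → *-comm c (f i))))

sumTo-suc : ∀ n (f : ℕ → ℚ) → sumTo (suc n) f ≡ f 0 + sumTo n (λ i → f (suc i))
sumTo-suc zero    f = refl
sumTo-suc (suc n) f = trans (cong (_+ f (suc (suc n))) (sumTo-suc n f)) (+-assoc (f 0) _ _)

sumTo-reverse : ∀ n (f : ℕ → ℚ) → sumTo n f ≡ sumTo n (λ i → f (n ∸ i))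
sumTo-reverse zero    f = refl
sumTo-reverse (suc n) f = begin
  sumTo n f + f (suc n)                          ≡⟨ +-comm (sumTo n f) _ ⟩
  f (suc n) + sumTo n f                          ≡⟨ cong (f (suc n) +_) (sumTo-reverse n f) ⟩
  f (suc n) + sumTo n (λ i → f (n ∸ i))          ≡⟨ sumTo-suc n (λ i → f (suc n ∸ i)) ⟨
  sumTo (suc n) (λ i → f (suc n ∸ i))            ∎

sumTo-swap : ∀ n m (f : ℕ → ℕ → ℚ) →
             sumTo n (λ i → sumTo m (f i)) ≡ sumTo m (λ j → sumTo n (λ i → f i j))
sumTo-swap zero    m f = refl
sumTo-swap (suc n) m f = trans (cong (_+ sumTo m (f (suc n))) (sumTo-swap n m f))
                               (sym (sumTo-+ m (λ j → sumTo n (λ i → f i j)) (f (suc n))))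

sumTo-triangle : ∀ n (f : ℕ → ℕ → ℚ) →
                 sumTo n (λ i → sumTo i (f i)) ≡ sumTo n (λ j → sumTo (n ∸ j) (λ k → f (j ℕ.+ k) j))
sumTo-triangle zero    f = refl
sumTo-triangle (suc n) f = begin
  sumTo n (λ i → sumTo i (f i)) + sumTo (suc n) (f (suc n))
    ≡⟨ cong (_+ sumTo (suc n) (f (suc n))) (sumTo-triangle n f) ⟩
  sumTo n (λ j → sumTo (n ∸ j) (column j)) + (sumTo n (f (suc n)) + f (suc n) (suc n))
    ≡⟨ +-assoc (sumTo n (λ j → sumTo (n ∸ j) (column j))) _ _ ⟨
  sumTo n (λ j → sumTo (n ∸ j) (column j)) + sumTo n (f (suc n)) + f (suc n) (suc n)
    ≡⟨ cong₂ _+_ (sym (sumTo-+ n _ _)) (sym last-column) ⟩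
  sumTo n (λ j → sumTo (n ∸ j) (column j) + f (suc n) j) + sumTo (suc n ∸ suc n) (column (suc n))
    ≡⟨ cong (_+ sumTo (suc n ∸ suc n) (column (suc n))) (sumTo-cong-≤ n (λ j≤n → sym (longer-column j≤n))) ⟩
  sumTo (suc n) (λ j → sumTo (suc n ∸ j) (column j)) ∎
  where
  column : ℕ → ℕ → ℚ
  column j k = f (j ℕ.+ k) j
  longer-column : ∀ {j} → j ℕ.≤ n → sumTo (suc n ∸ j) (column j) ≡ sumTo (n ∸ j) (column j) + f (suc n) j
  longer-column {j} j≤n rewrite ℕ.+-∸-assoc 1 j≤n =
    cong (λ i → sumTo (n ∸ j) (column j) + f i j) (trans (ℕ.+-suc j (n ∸ j)) (cong suc (ℕ.m+[n∸m]≡n j≤n)))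
  last-column : sumTo (suc n ∸ suc n) (column (suc n)) ≡ f (suc n) (suc n)
  last-column rewrite ℕ.n∸n≡0 n = cong (λ i → f i (suc n)) (ℕ.+-identityʳ (suc n))

sumTo-extend : ∀ {n} N (f : ℕ → ℚ) → n ℕ.≤ N → (∀ {i} → n ℕ.< i → f i ≡ 0ℚ) →
               sumTo N f ≡ sumTo n f
sumTo-extend {n} N f n≤N f≗0 with ℕ.m≤n⇒m<n∨m≡n n≤N
sumTo-extend         N       f n≤N f≗0 | inj₂ refl       = refl
sumTo-extend {n} (suc N) f n≤N f≗0 | inj₁ (s≤s n≤N′) =
  trans (cong₂ _+_ (sumTo-extend N f n≤N′ f≗0) (f≗0 (s≤s n≤N′))) (+-identityʳ (sumTo n f))

sumTo-pascal : ∀ m (b p q : ℕ → ℚ) →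
               b 0 ≡ q 0 → (∀ k → b (suc k) ≡ p k + q (suc k)) → q (suc m) ≡ 0ℚ →
               sumTo (suc m) b ≡ sumTo m p + sumTo m q
sumTo-pascal m b p q b0≡q0 b≡p+q qm≡0 = begin
  sumTo (suc m) b
    ≡⟨ sumTo-suc m b ⟩
  b 0 + sumTo m (λ k → b (suc k))
    ≡⟨ cong₂ _+_ b0≡q0 (sumTo-cong m b≡p+q) ⟩
  q 0 + sumTo m (λ k → p k + q (suc k))
    ≡⟨ cong (q 0 +_) (sumTo-+ m p (λ k → q (suc k))) ⟩
  q 0 + (sumTo m p + sumTo m (λ k → q (suc k)))
    ≡⟨ solve 3 (λ x y z → x :+ (y :+ z) := y :+ (x :+ z)) refl (q 0) (sumTo m p) _ ⟩
  sumTo m p + (q 0 + sumTo m (λ k → q (suc k)))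
    ≡⟨ cong (sumTo m p +_) (sumTo-suc m q) ⟨
  sumTo m p + (sumTo m q + q (suc m))
    ≡⟨ cong (λ z → sumTo m p + (sumTo m q + z)) qm≡0 ⟩
  sumTo m p + (sumTo m q + 0ℚ)
    ≡⟨ cong (sumTo m p +_) (+-identityʳ (sumTo m q)) ⟩
  sumTo m p + sumTo m q ∎
  where open +-*-Solver

infix 4 _≈_
_≈_ : Series → Series → Set
a ≈ b = ∀ n → a n ≡ b n

infixl 6 _⊕_
_⊕_ : Series → Series → Series
(a ⊕ b) n = a n + b n

zeroS : Series
zeroS _ = 0ℚ

constS : ℚ → Series
constS c zero    = c
constS c (suc _) = 0ℚ

≈-refl : ∀ {a} → a ≈ a
≈-refl n = refl

≈-sym : ∀ {a b} → a ≈ b → b ≈ a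
≈-sym a≈b n = sym (a≈b n)

≈-trans : ∀ {a b c} → a ≈ b → b ≈ c → a ≈ c
≈-trans a≈b b≈c n = trans (a≈b n) (b≈c n)

⊕-cong : ∀ {a b c d} → a ≈ b → c ≈ d → a ⊕ c ≈ b ⊕ d
⊕-cong a≈b c≈d n = cong₂ _+_ (a≈b n) (c≈d n)

⊛-cong : ∀ {a b c d} → a ≈ b → c ≈ d → (a ⊛ c) ≈ (b ⊛ d)
⊛-cong a≈b c≈d n = sumTo-cong n (λ i → cong₂ _*_ (a≈b i) (c≈d (n ∸ i)))

⊛-comm : ∀ a b → (a ⊛ b) ≈ (b ⊛ a)
⊛-comm a b n = trans (sumTo-reverse n (λ i → a i * b (n ∸ i))) (sumTo-cong-≤ n swap)
  where
  swap : ∀ {i} → i ℕ.≤ n → a (n ∸ i) * b (n ∸ (n ∸ i)) ≡ b i * a (n ∸ i)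
  swap {i} i≤n = trans (*-comm (a (n ∸ i)) _) (cong (λ j → b j * a (n ∸ i)) (ℕ.m∸[m∸n]≡n i≤n))

⊛-assoc : ∀ a b c → ((a ⊛ b) ⊛ c) ≈ (a ⊛ (b ⊛ c))
⊛-assoc a b c n = begin
  sumTo n (λ i → sumTo i (λ j → a j * b (i ∸ j)) * c (n ∸ i))
    ≡⟨ sumTo-cong n (λ i → sumTo-*ʳ i (c (n ∸ i)) _) ⟩
  sumTo n (λ i → sumTo i (λ j → a j * b (i ∸ j) * c (n ∸ i)))
    ≡⟨ sumTo-triangle n (λ i j → a j * b (i ∸ j) * c (n ∸ i)) ⟩
  sumTo n (λ j → sumTo (n ∸ j) (λ k → a j * b (j ℕ.+ k ∸ j) * c (n ∸ (j ℕ.+ k))))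
    ≡⟨ sumTo-cong n (λ j → sumTo-cong (n ∸ j) (λ k → reindex j k)) ⟩
  sumTo n (λ j → sumTo (n ∸ j) (λ k → a j * (b k * c (n ∸ j ∸ k))))
    ≡⟨ sumTo-cong n (λ j → sumTo-*ˡ (n ∸ j) (a j) (λ k → b k * c (n ∸ j ∸ k))) ⟨
  sumTo n (λ j → a j * sumTo (n ∸ j) (λ k → b k * c (n ∸ j ∸ k))) ∎
  where
  reindex : ∀ j k → a j * b (j ℕ.+ k ∸ j) * c (n ∸ (j ℕ.+ k)) ≡ a j * (b k * c (n ∸ j ∸ k))
  reindex j k = trans (*-assoc (a j) _ _)
    (cong₂ (λ k′ l → a j * (b k′ * c l)) (ℕ.m+n∸m≡n j k) (sym (ℕ.∸-+-assoc n j k)))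

constS-⊛ : ∀ c a n → (constS c ⊛ a) n ≡ c * a n
constS-⊛ c a zero    = refl
constS-⊛ c a (suc n) = begin
  (constS c ⊛ a) (suc n)
    ≡⟨ sumTo-suc n (λ i → constS c i * a (suc n ∸ i)) ⟩
  c * a (suc n) + sumTo n (λ i → 0ℚ * a (n ∸ i))
    ≡⟨ cong (c * a (suc n) +_) (sumTo-zero n (λ {i} _ → *-zeroˡ (a (n ∸ i)))) ⟩
  c * a (suc n) + 0ℚ
    ≡⟨ +-identityʳ (c * a (suc n)) ⟩
  c * a (suc n) ∎

constS-1 : constS 1ℚ ≈ oneS
constS-1 zero    = refl
constS-1 (suc n) = refl

constS-+ : ∀ x y → constS (x + y) ≈ constS x ⊕ constS y
constS-+ x y zero    = refl
constS-+ x y (suc n) = refl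

constS-* : ∀ x y → constS (x * y) ≈ (constS x ⊛ constS y)
constS-* x y zero    = refl
constS-* x y (suc n) = sym (trans (constS-⊛ x (constS y) (suc n)) (*-zeroʳ x))

⊛-identityˡ : ∀ a → (oneS ⊛ a) ≈ a
⊛-identityˡ a n = trans (⊛-cong (≈-sym constS-1) (≈-refl {a}) n) (trans (constS-⊛ 1ℚ a n) (*-identityˡ (a n)))

⊛-zeroˡ : ∀ a → (zeroS ⊛ a) ≈ zeroS
⊛-zeroˡ a n = sumTo-zero n (λ {i} _ → *-zeroˡ (a (n ∸ i)))

⊛-distribʳ : ∀ a b c → ((b ⊕ c) ⊛ a) ≈ (b ⊛ a) ⊕ (c ⊛ a)
⊛-distribʳ a b c n =
  trans (sumTo-cong n (λ i → *-distribʳ-+ (a (n ∸ i)) (b i) (c i))) (sumTo-+ n (λ i → b i * a (n ∸ i)) _)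

Series-commutativeSemiring : CommutativeSemiring 0ℓ 0ℓ
Series-commutativeSemiring = record
  { Carrier = Series ; _≈_ = _≈_ ; _+_ = _⊕_ ; _*_ = _⊛_ ; 0# = zeroS ; 1# = oneS
  ; isCommutativeSemiring = record
    { isSemiring = record
      { isSemiringWithoutAnnihilatingZero = record
        { +-isCommutativeMonoid = record
          { isMonoid = record
            { isSemigroup = record
              { isMagma = record
                { isEquivalence = record { refl = ≈-refl ; sym = ≈-sym ; trans = ≈-trans }
                ; ∙-cong = ⊕-cong }
              ; assoc = λ a b c n → +-assoc (a n) (b n) (c n) }
            ; identity = (λ a n → +-identityˡ (a n)) , (λ a n → +-identityʳ (a n)) }
          ; comm = λ a b n → +-comm (a n) (b n) }
        ; *-cong = ⊛-cong
        ; *-assoc = ⊛-assoc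
        ; *-identity = ⊛-identityˡ , (λ a → ≈-trans (⊛-comm a oneS) (⊛-identityˡ a))
        ; distrib = (λ a b c → ≈-trans (⊛-comm a (b ⊕ c))
                                 (≈-trans (⊛-distribʳ a b c) (⊕-cong (⊛-comm b a) (⊛-comm c a))))
                  , ⊛-distribʳ }
      ; zero = ⊛-zeroˡ , (λ a → ≈-trans (⊛-comm a zeroS) (⊛-zeroˡ a)) }
    ; *-comm = ⊛-comm } }

module S = SemiringSolver Series-commutativeSemiring
open S using () renaming (_:+_ to _⊞_; _:*_ to _⊠_; _:=_ to _≐_; con to ĉ)

∂ : Series → Series
∂ a n = ofℕ (suc n) * a (suc n)

∂-cong : ∀ {a b} → a ≈ b → ∂ a ≈ ∂ b
∂-cong a≈b n = cong (ofℕ (suc n) *_) (a≈b (suc n))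

∂-⊕ : ∀ a b → ∂ (a ⊕ b) ≈ ∂ a ⊕ ∂ b
∂-⊕ a b n = *-distribˡ-+ (ofℕ (suc n)) (a (suc n)) (b (suc n))

∂-oneS : ∂ oneS ≈ zeroS
∂-oneS n = *-zeroʳ (ofℕ (suc n))

∂-⊛ : ∀ a b → ∂ (a ⊛ b) ≈ (∂ a ⊛ b) ⊕ (a ⊛ ∂ b)
∂-⊛ a b n = sym (begin
  (∂ a ⊛ b) n + (a ⊛ ∂ b) n
    ≡⟨ cong₂ _+_ left-weights right-weights ⟩
  sumTo (suc n) (λ i → ofℕ i * f i) + sumTo (suc n) (λ i → ofℕ (suc n ∸ i) * f i)
    ≡⟨ sumTo-+ (suc n) (λ i → ofℕ i * f i) _ ⟨
  sumTo (suc n) (λ i → ofℕ i * f i + ofℕ (suc n ∸ i) * f i)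
    ≡⟨ sumTo-cong-≤ (suc n) weights-add-up ⟩
  sumTo (suc n) (λ i → ofℕ (suc n) * f i)
    ≡⟨ sumTo-*ˡ (suc n) (ofℕ (suc n)) f ⟨
  ∂ (a ⊛ b) n ∎)
  where
  open +-*-Solver
  f : ℕ → ℚ
  f i = a i * b (suc n ∸ i)
  left-weights : (∂ a ⊛ b) n ≡ sumTo (suc n) (λ i → ofℕ i * f i)
  left-weights = sym (begin
    sumTo (suc n) (λ i → ofℕ i * f i)
      ≡⟨ sumTo-suc n (λ i → ofℕ i * f i) ⟩
    0ℚ * f 0 + sumTo n (λ i → ofℕ (suc i) * f (suc i))
      ≡⟨ cong (_+ sumTo n (λ i → ofℕ (suc i) * f (suc i))) (*-zeroˡ (f 0)) ⟩
    0ℚ + sumTo n (λ i → ofℕ (suc i) * f (suc i))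
      ≡⟨ +-identityˡ _ ⟩
    sumTo n (λ i → ofℕ (suc i) * f (suc i))
      ≡⟨ sumTo-cong n (λ i → *-assoc (ofℕ (suc i)) (a (suc i)) (b (n ∸ i))) ⟨
    (∂ a ⊛ b) n ∎)
  last-weight-0 : ofℕ (suc n ∸ suc n) * f (suc n) ≡ 0ℚ
  last-weight-0 rewrite ℕ.n∸n≡0 n = *-zeroˡ (a (suc n) * b 0)
  shift-weight : ∀ {i} → i ℕ.≤ n → ofℕ (suc n ∸ i) * f i ≡ a i * ∂ b (n ∸ i)
  shift-weight {i} i≤n rewrite ℕ.+-∸-assoc 1 i≤n =
    solve 3 (λ w x y → w :* (x :* y) := x :* (w :* y)) refl (ofℕ (suc (n ∸ i))) (a i) (b (suc (n ∸ i)))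
  right-weights : (a ⊛ ∂ b) n ≡ sumTo (suc n) (λ i → ofℕ (suc n ∸ i) * f i)
  right-weights = sym (begin
    sumTo n (λ i → ofℕ (suc n ∸ i) * f i) + ofℕ (suc n ∸ suc n) * f (suc n)
      ≡⟨ cong (sumTo n (λ i → ofℕ (suc n ∸ i) * f i) +_) last-weight-0 ⟩
    sumTo n (λ i → ofℕ (suc n ∸ i) * f i) + 0ℚ
      ≡⟨ +-identityʳ _ ⟩
    sumTo n (λ i → ofℕ (suc n ∸ i) * f i)
      ≡⟨ sumTo-cong-≤ n shift-weight ⟩
    (a ⊛ ∂ b) n ∎)
  weights-add-up : ∀ {i} → i ℕ.≤ suc n → ofℕ i * f i + ofℕ (suc n ∸ i) * f i ≡ ofℕ (suc n) * f i
  weights-add-up {i} i≤1+n = trans (sym (*-distribʳ-+ (f i) (ofℕ i) _))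
    (cong (_* f i) (trans (sym (ofℕ-+ i (suc n ∸ i))) (cong ofℕ (ℕ.m+[n∸m]≡n i≤1+n))))

∂-powS : ∀ a k → ∂ (powS a (suc k)) ≈ (constS (ofℕ (suc k)) ⊛ (powS a k ⊛ ∂ a))
∂-powS a zero n = begin
  ∂ (a ⊛ oneS) n
    ≡⟨ ∂-⊛ a oneS n ⟩
  ((∂ a ⊛ oneS) ⊕ (a ⊛ ∂ oneS)) n
    ≡⟨ ⊕-cong (≈-refl {∂ a ⊛ oneS}) (⊛-cong (≈-refl {a}) ∂-oneS) n ⟩
  ((∂ a ⊛ oneS) ⊕ (a ⊛ zeroS)) n
    ≡⟨ S.solve 2 (λ x y → y ⊠ ĉ 1 ⊞ x ⊠ ĉ 0 ≐ ĉ 1 ⊠ (ĉ 1 ⊠ y)) (λ _ → refl) a (∂ a) n ⟩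
  (oneS ⊛ (oneS ⊛ ∂ a)) n
    ≡⟨ ⊛-cong (≈-sym constS-1) (≈-refl {oneS ⊛ ∂ a}) n ⟩
  (constS 1ℚ ⊛ (oneS ⊛ ∂ a)) n ∎
∂-powS a (suc k) n = begin
  ∂ (a ⊛ powS a (suc k)) n
    ≡⟨ ∂-⊛ a (powS a (suc k)) n ⟩
  ((∂ a ⊛ powS a (suc k)) ⊕ (a ⊛ ∂ (powS a (suc k)))) n
    ≡⟨ ⊕-cong (≈-refl {∂ a ⊛ powS a (suc k)}) (⊛-cong (≈-refl {a}) (∂-powS a k)) n ⟩
  ((∂ a ⊛ powS a (suc k)) ⊕ (a ⊛ (K ⊛ (powS a k ⊛ ∂ a)))) n
    ≡⟨ S.solve 4 (λ x p y k → y ⊠ (x ⊠ p) ⊞ x ⊠ (k ⊠ (p ⊠ y)) ≐ (ĉ 1 ⊞ k) ⊠ ((x ⊠ p) ⊠ y))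
               (λ _ → refl) a (powS a k) (∂ a) K n ⟩
  ((oneS ⊕ K) ⊛ (powS a (suc k) ⊛ ∂ a)) n
    ≡⟨ ⊛-cong 1+K (≈-refl {powS a (suc k) ⊛ ∂ a}) n ⟩
  (constS (ofℕ (suc (suc k))) ⊛ (powS a (suc k) ⊛ ∂ a)) n ∎
  where
  K = constS (ofℕ (suc k))
  1+K : oneS ⊕ K ≈ constS (ofℕ (suc (suc k)))
  1+K = ≈-trans (⊕-cong (≈-sym constS-1) (≈-refl {K}))
        (≈-trans (≈-sym (constS-+ 1ℚ (ofℕ (suc k))))
                 (λ i → cong (λ c → constS c i) (sym (ofℕ-suc (suc k)))))

∂^ : ℕ → Series → Series
∂^ zero    a = a
∂^ (suc m) a = ∂ (∂^ m a)

∂^-coefficient : ∀ m n a → ofℕ (n !) * ∂^ m a n ≡ ofℕ ((n ℕ.+ m) !) * a (n ℕ.+ m)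
∂^-coefficient zero    n a = cong (λ i → ofℕ (i !) * a i) (sym (ℕ.+-identityʳ n))
∂^-coefficient (suc m) n a = begin
  ofℕ (n !) * (ofℕ (suc n) * ∂^ m a (suc n))
    ≡⟨ *-assoc (ofℕ (n !)) (ofℕ (suc n)) _ ⟨
  ofℕ (n !) * ofℕ (suc n) * ∂^ m a (suc n)
    ≡⟨ cong (_* ∂^ m a (suc n)) (trans (*-comm (ofℕ (n !)) _) (sym (ofℕ-* (suc n) (n !)))) ⟩
  ofℕ (suc n !) * ∂^ m a (suc n)
    ≡⟨ ∂^-coefficient m (suc n) a ⟩
  ofℕ ((suc n ℕ.+ m) !) * a (suc n ℕ.+ m)
    ≡⟨ cong (λ i → ofℕ (i !) * a i) (ℕ.+-suc n m) ⟨
  ofℕ ((n ℕ.+ suc m) !) * a (n ℕ.+ suc m) ∎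

!-*-⊛ : ∀ a b n → ofℕ (n !) * (a ⊛ b) n
                 ≡ sumTo n (λ l → ofℕ (n C l) * (ofℕ (l !) * a l) * (ofℕ ((n ∸ l) !) * b (n ∸ l)))
!-*-⊛ a b n = trans (sumTo-*ˡ n (ofℕ (n !)) (λ l → a l * b (n ∸ l))) (sumTo-cong-≤ n term)
  where
  open +-*-Solver
  term : ∀ {l} → l ℕ.≤ n → ofℕ (n !) * (a l * b (n ∸ l))
                           ≡ ofℕ (n C l) * (ofℕ (l !) * a l) * (ofℕ ((n ∸ l) !) * b (n ∸ l))
  term {l} l≤n = begin
    ofℕ (n !) * (a l * b (n ∸ l))
      ≡⟨ cong (_* (a l * b (n ∸ l))) (ofℕ-binomial l≤n) ⟨
    ofℕ (n C l) * (ofℕ (l !) * ofℕ ((n ∸ l) !)) * (a l * b (n ∸ l))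
      ≡⟨ solve 5 (λ c i j x y → c :* (i :* j) :* (x :* y) := c :* (i :* x) :* (j :* y)) refl
               (ofℕ (n C l)) (ofℕ (l !)) (ofℕ ((n ∸ l) !)) (a l) (b (n ∸ l)) ⟩
    ofℕ (n C l) * (ofℕ (l !) * a l) * (ofℕ ((n ∸ l) !) * b (n ∸ l)) ∎

powS-vanish : ∀ a → a 0 ≡ 0ℚ → ∀ {k n} → n ℕ.< k → powS a k n ≡ 0ℚ
powS-vanish a a0≡0 {suc k} {zero}  _         = trans (cong (_* powS a k 0) a0≡0) (*-zeroˡ (powS a k 0))
powS-vanish a a0≡0 {suc k} {suc n} (s≤s n<k) = begin
  (a ⊛ powS a k) (suc n)
    ≡⟨ sumTo-suc n (λ i → a i * powS a k (suc n ∸ i)) ⟩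
  a 0 * powS a k (suc n) + sumTo n (λ i → a (suc i) * powS a k (n ∸ i))
    ≡⟨ cong₂ _+_ first-term (sumTo-zero n (λ {i} _ → later-term i)) ⟩
  0ℚ + 0ℚ
    ≡⟨ +-identityʳ 0ℚ ⟩
  0ℚ ∎
  where
  first-term : a 0 * powS a k (suc n) ≡ 0ℚ
  first-term = trans (cong (_* powS a k (suc n)) a0≡0) (*-zeroˡ (powS a k (suc n)))
  later-term : ∀ i → a (suc i) * powS a k (n ∸ i) ≡ 0ℚ
  later-term i = trans (cong (a (suc i) *_) (powS-vanish a a0≡0 (ℕ.≤-<-trans (ℕ.m∸n≤m n i) n<k)))
                       (*-zeroʳ (a (suc i)))

powS-scaleS : ∀ c a k n → powS (scaleS c a) k n ≡ c ^ℚ k * powS a k n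
powS-scaleS c a zero    n = sym (*-identityˡ (oneS n))
powS-scaleS c a (suc k) n = begin
  sumTo n (λ i → c * a i * powS (scaleS c a) k (n ∸ i))
    ≡⟨ sumTo-cong n (λ i → trans (cong (c * a i *_) (powS-scaleS c a k (n ∸ i)))
                                 (rearrange (a i) (powS a k (n ∸ i)))) ⟩
  sumTo n (λ i → c ^ℚ suc k * (a i * powS a k (n ∸ i)))
    ≡⟨ sumTo-*ˡ n (c ^ℚ suc k) _ ⟨
  c ^ℚ suc k * powS a (suc k) n ∎
  where
  open +-*-Solver
  rearrange : ∀ x y → c * x * (c ^ℚ k * y) ≡ c * c ^ℚ k * (x * y)
  rearrange x y = solve 4 (λ c x ck y → c :* x :* (ck :* y) := c :* ck :* (x :* y)) refl c x (c ^ℚ k) y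

-- g = 1/(1 − v); adding w = − v instead of subtracting keeps the algebra inside the series semiring.
linear-fixpoint : ∀ {v g a x} → g ≈ oneS ⊕ (v ⊛ g) → x ≈ a ⊕ (v ⊛ x) → x ≈ (a ⊛ g)
linear-fixpoint {v} {g} {a} {x} g≈1+vg x≈a+vx n = begin
  x n
    ≡⟨ S.solve 2 (λ x g → x ≐ x ⊠ (ĉ 1 ⊞ ĉ 0 ⊠ g)) (λ _ → refl) x g n ⟩
  (x ⊛ (oneS ⊕ (zeroS ⊛ g))) n
    ≡⟨ ⊛-cong (≈-refl {x}) (⊕-cong (≈-refl {oneS}) (⊛-cong (≈-sym v-w≈0) (≈-refl {g}))) n ⟩
  (x ⊛ (oneS ⊕ ((v ⊕ w) ⊛ g))) n
    ≡⟨ S.solve 4 (λ x g v w → x ⊠ (ĉ 1 ⊞ (v ⊞ w) ⊠ g) ≐ x ⊠ (ĉ 1 ⊞ v ⊠ g) ⊞ w ⊠ x ⊠ g)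
               (λ _ → refl) x g v w n ⟩
  ((x ⊛ (oneS ⊕ (v ⊛ g))) ⊕ ((w ⊛ x) ⊛ g)) n
    ≡⟨ ⊕-cong (⊛-cong x≈a+vx (≈-sym g≈1+vg)) (≈-refl {(w ⊛ x) ⊛ g}) n ⟩
  (((a ⊕ (v ⊛ x)) ⊛ g) ⊕ ((w ⊛ x) ⊛ g)) n
    ≡⟨ S.solve 5 (λ x g v w a → (a ⊞ v ⊠ x) ⊠ g ⊞ w ⊠ x ⊠ g ≐ a ⊠ g ⊞ (v ⊞ w) ⊠ (x ⊠ g))
               (λ _ → refl) x g v w a n ⟩
  ((a ⊛ g) ⊕ ((v ⊕ w) ⊛ (x ⊛ g))) n
    ≡⟨ ⊕-cong (≈-refl {a ⊛ g}) (⊛-cong v-w≈0 (≈-refl {x ⊛ g})) n ⟩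
  ((a ⊛ g) ⊕ (zeroS ⊛ (x ⊛ g))) n
    ≡⟨ S.solve 3 (λ x g a → a ⊠ g ⊞ ĉ 0 ⊠ (x ⊠ g) ≐ a ⊠ g) (λ _ → refl) x g a n ⟩
  (a ⊛ g) n ∎
  where
  w : Series
  w i = - v i
  v-w≈0 : v ⊕ w ≈ zeroS
  v-w≈0 i = +-inverseʳ (v i)

module _ (v : Series) (v0≡0 : v 0 ≡ 0ℚ) where

  geomS-extend : ∀ {m N} → m ℕ.≤ N → sumTo N (λ j → powS v j m) ≡ geomS v m
  geomS-extend {m} {N} m≤N = sumTo-extend N (λ j → powS v j m) m≤N (powS-vanish v v0≡0)

  geomS-unfold : geomS v ≈ oneS ⊕ (v ⊛ geomS v)
  geomS-unfold zero = sym (begin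
    1ℚ + v 0 * geomS v 0   ≡⟨ cong (λ c → 1ℚ + c * geomS v 0) v0≡0 ⟩
    1ℚ + 0ℚ * geomS v 0    ≡⟨ cong (1ℚ +_) (*-zeroˡ (geomS v 0)) ⟩
    1ℚ + 0ℚ                ≡⟨ +-identityʳ 1ℚ ⟩
    1ℚ                     ∎)
  geomS-unfold (suc n) = begin
    sumTo (suc n) (λ j → powS v j (suc n))
      ≡⟨ sumTo-suc n (λ j → powS v j (suc n)) ⟩
    0ℚ + sumTo n (λ j → sumTo (suc n) (λ i → v i * powS v j (suc n ∸ i)))
      ≡⟨ cong (0ℚ +_) (sumTo-swap n (suc n) (λ j i → v i * powS v j (suc n ∸ i))) ⟩
    0ℚ + sumTo (suc n) (λ i → sumTo n (λ j → v i * powS v j (suc n ∸ i)))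
      ≡⟨ cong (0ℚ +_) (sumTo-cong (suc n) (λ i → sumTo-*ˡ n (v i) (λ j → powS v j (suc n ∸ i)))) ⟨
    0ℚ + sumTo (suc n) (λ i → v i * sumTo n (λ j → powS v j (suc n ∸ i)))
      ≡⟨ cong (0ℚ +_) (sumTo-cong (suc n) truncate) ⟩
    0ℚ + (v ⊛ geomS v) (suc n) ∎
    where
    truncate : ∀ i → v i * sumTo n (λ j → powS v j (suc n ∸ i)) ≡ v i * geomS v (suc n ∸ i)
    v0* : ∀ x → v 0 * x ≡ 0ℚ
    v0* x = trans (cong (_* x) v0≡0) (*-zeroˡ x)
    truncate zero    = trans (v0* _) (sym (v0* (geomS v (suc n))))
    truncate (suc i) = cong (v (suc i) *_) (geomS-extend (ℕ.m∸n≤m n i))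

  ∂-geomS : ∂ (geomS v) ≈ ((∂ v ⊛ geomS v) ⊛ geomS v)
  ∂-geomS = linear-fixpoint {v} {geomS v} {∂ v ⊛ geomS v} geomS-unfold (λ n → begin
    ∂ (geomS v) n                                      ≡⟨ ∂-cong geomS-unfold n ⟩
    ∂ (oneS ⊕ (v ⊛ geomS v)) n                         ≡⟨ ∂-⊕ oneS (v ⊛ geomS v) n ⟩
    ∂ oneS n + ∂ (v ⊛ geomS v) n                       ≡⟨ cong₂ _+_ (∂-oneS n) (∂-⊛ v (geomS v) n) ⟩
    0ℚ + ((∂ v ⊛ geomS v) ⊕ (v ⊛ ∂ (geomS v))) n       ≡⟨ +-identityˡ _ ⟩
    ((∂ v ⊛ geomS v) ⊕ (v ⊛ ∂ (geomS v))) n            ∎)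

module _ (lam : ℚ) where

  fallingλ-suc : ∀ x n → fallingλ lam x (suc n) ≡ x * fallingλ lam (x - lam) n
  fallingλ-suc x zero = solve 2 (λ x l → con 1ℚ :* (x :- con 0ℚ :* l) := x :* con 1ℚ) refl x lam
    where open +-*-Solver
  fallingλ-suc x (suc n) = begin
    fallingλ lam x (suc n) * (x - ofℕ (suc n) * lam)
      ≡⟨ cong₂ _*_ (fallingλ-suc x n) (cong (λ c → x - c * lam) (ofℕ-suc n)) ⟩
    x * fallingλ lam (x - lam) n * (x - (1ℚ + ofℕ n) * lam)
      ≡⟨ solve 4 (λ x F l m → x :* F :* (x :- (con 1ℚ :+ m) :* l) := x :* (F :* ((x :- l) :- m :* l)))
               refl x (fallingλ lam (x - lam) n) lam (ofℕ n) ⟩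
    x * (fallingλ lam (x - lam) n * ((x - lam) - ofℕ n * lam)) ∎
    where open +-*-Solver

  fallingλ-0 : ∀ n → fallingλ lam 0ℚ (suc n) ≡ 0ℚ
  fallingλ-0 n = trans (fallingλ-suc 0ℚ n) (*-zeroˡ (fallingλ lam (0ℚ - lam) n))

  ∂-eλ^ : ∀ x → ∂ (eλ^ lam x) ≈ (constS x ⊛ eλ^ lam (x - lam))
  ∂-eλ^ x n = begin
    ofℕ (suc n) * (fallingλ lam x (suc n) * inv! (suc n))
      ≡⟨ cong (λ F → ofℕ (suc n) * (F * inv! (suc n))) (fallingλ-suc x n) ⟩
    ofℕ (suc n) * (x * F * inv! (suc n))
      ≡⟨ solve 4 (λ c x F i → c :* (x :* F :* i) := x :* (F :* (c :* i))) refl (ofℕ (suc n)) x F (inv! (suc n)) ⟩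
    x * (F * (ofℕ (suc n) * inv! (suc n)))
      ≡⟨ cong (λ i → x * (F * i)) (inv!-suc n) ⟩
    x * eλ^ lam (x - lam) n
      ≡⟨ constS-⊛ x (eλ^ lam (x - lam)) n ⟨
    (constS x ⊛ eλ^ lam (x - lam)) n ∎
    where
    open +-*-Solver
    F = fallingλ lam (x - lam) n

  -- Both sides have constant term 1 and, by ∂-eλ^, derivatives that match under the induction hypothesis.
  eλ^-+ : ∀ a b → (eλ^ lam a ⊛ eλ^ lam b) ≈ eλ^ lam (a + b)
  eλ^-+ a b zero    = refl
  eλ^-+ a b (suc n) = ofℕ-suc-cancelˡ n (begin
    ∂ (e a ⊛ e b) n
      ≡⟨ ∂-⊛ (e a) (e b) n ⟩
    (∂ (e a) ⊛ e b) n + (e a ⊛ ∂ (e b)) n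
      ≡⟨ cong₂ _+_ (⊛-cong (∂-eλ^ a) (≈-refl {e b}) n) (⊛-cong (≈-refl {e a}) (∂-eλ^ b) n) ⟩
    ((constS a ⊛ e (a - lam)) ⊛ e b) n + (e a ⊛ (constS b ⊛ e (b - lam))) n
      ≡⟨ cong₂ _+_ (⊛-assoc (constS a) (e (a - lam)) (e b) n)
                   (S.solve 3 (λ x c y → x ⊠ (c ⊠ y) ≐ c ⊠ (x ⊠ y)) (λ _ → refl)
                              (e a) (constS b) (e (b - lam)) n) ⟩
    (constS a ⊛ (e (a - lam) ⊛ e b)) n + (constS b ⊛ (e a ⊛ e (b - lam))) n
      ≡⟨ cong₂ _+_ (constS-⊛ a (e (a - lam) ⊛ e b) n) (constS-⊛ b (e a ⊛ e (b - lam)) n) ⟩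
    a * (e (a - lam) ⊛ e b) n + b * (e a ⊛ e (b - lam)) n
      ≡⟨ cong₂ (λ p q → a * p + b * q) (eλ^-+ (a - lam) b n) (eλ^-+ a (b - lam) n) ⟩
    a * e (a - lam + b) n + b * e (a + (b - lam)) n
      ≡⟨ cong₂ (λ p q → a * e p n + b * e q n)
               (solve 3 (λ a b l → a :- l :+ b := a :+ b :- l) refl a b lam)
               (solve 3 (λ a b l → a :+ (b :- l) := a :+ b :- l) refl a b lam) ⟩
    a * e (a + b - lam) n + b * e (a + b - lam) n
      ≡⟨ *-distribʳ-+ (e (a + b - lam) n) a b ⟨
    (a + b) * e (a + b - lam) n
      ≡⟨ trans (∂-eλ^ (a + b) n) (constS-⊛ (a + b) (e (a + b - lam)) n) ⟨
    ∂ (e (a + b)) n ∎)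
    where
    open +-*-Solver
    e = eλ^ lam

  eλ^-0 : eλ^ lam 0ℚ ≈ oneS
  eλ^-0 zero    = refl
  eλ^-0 (suc n) = trans (cong (_* inv! (suc n)) (fallingλ-0 n)) (*-zeroˡ (inv! (suc n)))

  eλ^-λ-1 : eλ^ lam lam 1 ≡ lam
  eλ^-λ-1 = solve 1 (λ l → con 1ℚ :* (l :- con 0ℚ :* l) :* con 1ℚ := l) refl lam
    where open +-*-Solver

  eλ^-λ-≥2 : ∀ i → eλ^ lam lam (suc (suc i)) ≡ 0ℚ
  eλ^-λ-≥2 i = begin
    fallingλ lam lam (2 ℕ.+ i) * inv! (2 ℕ.+ i)
      ≡⟨ cong (_* inv! (2 ℕ.+ i)) (fallingλ-suc lam (suc i)) ⟩
    lam * fallingλ lam (lam - lam) (suc i) * inv! (2 ℕ.+ i)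
      ≡⟨ cong (λ x → lam * fallingλ lam x (suc i) * inv! (2 ℕ.+ i)) (+-inverseʳ lam) ⟩
    lam * fallingλ lam 0ℚ (suc i) * inv! (2 ℕ.+ i)
      ≡⟨ cong (λ F → lam * F * inv! (2 ℕ.+ i)) (fallingλ-0 i) ⟩
    lam * 0ℚ * inv! (2 ℕ.+ i)
      ≡⟨ cong (_* inv! (2 ℕ.+ i)) (*-zeroʳ lam) ⟩
    0ℚ * inv! (2 ℕ.+ i)
      ≡⟨ *-zeroˡ (inv! (2 ℕ.+ i)) ⟩
    0ℚ ∎

  eλ^-λ-⊛ : ∀ w m → (eλ^ lam lam ⊛ w) (suc m) ≡ w (suc m) + lam * w m
  eλ^-λ-⊛ w zero = cong₂ _+_ (*-identityˡ (w 1)) (cong (_* w 0) eλ^-λ-1)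
  eλ^-λ-⊛ w (suc m) = begin
    (e ⊛ w) (2 ℕ.+ m)
      ≡⟨ sumTo-suc (suc m) (λ i → e i * w (2 ℕ.+ m ∸ i)) ⟩
    e 0 * w (2 ℕ.+ m) + sumTo (suc m) (λ i → e (suc i) * w (suc m ∸ i))
      ≡⟨ cong (e 0 * w (2 ℕ.+ m) +_) (sumTo-suc m (λ i → e (suc i) * w (suc m ∸ i))) ⟩
    e 0 * w (2 ℕ.+ m) + (e 1 * w (suc m) + sumTo m (λ i → e (2 ℕ.+ i) * w (m ∸ i)))
      ≡⟨ cong₂ (λ p q → p + (q * w (suc m) + sumTo m (λ i → e (2 ℕ.+ i) * w (m ∸ i))))
               (*-identityˡ (w (2 ℕ.+ m))) eλ^-λ-1 ⟩
    w (2 ℕ.+ m) + (lam * w (suc m) + sumTo m (λ i → e (2 ℕ.+ i) * w (m ∸ i)))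
      ≡⟨ cong (λ s → w (2 ℕ.+ m) + (lam * w (suc m) + s)) (sumTo-zero m (λ {i} _ → higher-term i)) ⟩
    w (2 ℕ.+ m) + (lam * w (suc m) + 0ℚ)
      ≡⟨ cong (w (2 ℕ.+ m) +_) (+-identityʳ (lam * w (suc m))) ⟩
    w (2 ℕ.+ m) + lam * w (suc m) ∎
    where
    e = eλ^ lam lam
    higher-term : ∀ i → e (2 ℕ.+ i) * w (m ∸ i) ≡ 0ℚ
    higher-term i = trans (cong (_* w (m ∸ i)) (eλ^-λ-≥2 i)) (*-zeroˡ (w (m ∸ i)))

  eλ^-λ-⊛-∂ : ∀ a m → (eλ^ lam lam ⊛ ∂ a) m ≡ ofℕ (suc m) * a (suc m) + lam * (ofℕ m * a m)
  eλ^-λ-⊛-∂ a zero    =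
    solve 3 (λ x y l → con 1ℚ :* (con 1ℚ :* x) := con 1ℚ :* x :+ l :* (con 0ℚ :* y)) refl (a 1) (a 0) lam
    where open +-*-Solver
  eλ^-λ-⊛-∂ a (suc m) = eλ^-λ-⊛ (∂ a) m

orderedStirling2λ : ℚ → ℕ → ℕ → ℚ
orderedStirling2λ lam m k = ofℕ (m !) * powS (minusOneS (eλ lam)) k m

ofℕ-!-*-stirling2λ : ∀ lam m k → ofℕ (k !) * stirling2λ lam m k ≡ orderedStirling2λ lam m k
ofℕ-!-*-stirling2λ lam m k = begin
  ofℕ (k !) * (ofℕ (m !) * (inv! k * U))
    ≡⟨ solve 4 (λ a b i p → a :* (b :* (i :* p)) := (a :* i) :* (b :* p)) refl
               (ofℕ (k !)) (ofℕ (m !)) (inv! k) U ⟩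
  ofℕ (k !) * inv! k * (ofℕ (m !) * U)
    ≡⟨ cong (_* (ofℕ (m !) * U)) (ofℕ-!-inv! k) ⟩
  1ℚ * (ofℕ (m !) * U)
    ≡⟨ *-identityˡ _ ⟩
  ofℕ (m !) * U ∎
  where
  open +-*-Solver
  U = powS (minusOneS (eλ lam)) k m

module _ (lam : ℚ) where

  private
    u : Series
    u = minusOneS (eλ lam)

  ∂-eλ : ∂ (eλ lam) ≈ eλ^ lam (1ℚ - lam)
  ∂-eλ n = trans (∂-eλ^ lam 1ℚ n) (trans (constS-⊛ 1ℚ (eλ^ lam (1ℚ - lam)) n) (*-identityˡ _))

  eλ≈1+u : eλ lam ≈ oneS ⊕ u
  eλ≈1+u zero    = refl
  eλ≈1+u (suc n) = sym (+-identityˡ (u (suc n)))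

  eλ^-λ-⊛-∂-powS : ∀ k → (eλ^ lam lam ⊛ ∂ (powS u (suc k)))
                          ≈ (constS (ofℕ (suc k)) ⊛ (powS u k ⊕ powS u (suc k)))
  eλ^-λ-⊛-∂-powS k n = begin
    (e lam ⊛ ∂ (powS u (suc k))) n
      ≡⟨ ⊛-cong (≈-refl {e lam}) (∂-powS u k) n ⟩
    (e lam ⊛ (K ⊛ (powS u k ⊛ ∂ u))) n
      ≡⟨ S.solve 4 (λ e k p d → e ⊠ (k ⊠ (p ⊠ d)) ≐ k ⊠ (p ⊠ (e ⊠ d)))
                 (λ _ → refl) (e lam) K (powS u k) (∂ u) n ⟩
    (K ⊛ (powS u k ⊛ (e lam ⊛ ∂ u))) n
      ≡⟨ ⊛-cong (≈-refl {K}) (⊛-cong (≈-refl {powS u k}) eλ⊛∂u≈1+u) n ⟩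
    (K ⊛ (powS u k ⊛ (oneS ⊕ u))) n
      ≡⟨ S.solve 3 (λ k p u → k ⊠ (p ⊠ (ĉ 1 ⊞ u)) ≐ k ⊠ (p ⊞ u ⊠ p))
                 (λ _ → refl) K (powS u k) u n ⟩
    (K ⊛ (powS u k ⊕ powS u (suc k))) n ∎
    where
    e = eλ^ lam
    K = constS (ofℕ (suc k))
    eλ⊛∂u≈1+u : (e lam ⊛ ∂ u) ≈ oneS ⊕ u
    eλ⊛∂u≈1+u = ≈-trans (⊛-cong (≈-refl {e lam}) ∂-eλ)
                (≈-trans (eλ^-+ lam lam (1ℚ - lam))
                (≈-trans (λ i → cong (λ x → e x i) (solve 1 (λ l → l :+ (con 1ℚ :- l) := con 1ℚ) refl lam))
                eλ≈1+u))
      where open +-*-Solver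

  orderedStirling2λ-vanish : ∀ {m k} → m ℕ.< k → orderedStirling2λ lam m k ≡ 0ℚ
  orderedStirling2λ-vanish {m} m<k = trans (cong (ofℕ (m !) *_) (powS-vanish u refl m<k)) (*-zeroʳ (ofℕ (m !)))

  orderedStirling2λ-suc-zero : ∀ m → orderedStirling2λ lam (suc m) 0
                                     ≡ (ofℕ 0 - ofℕ m * lam) * orderedStirling2λ lam m 0
  orderedStirling2λ-suc-zero zero    =
    solve 1 (λ l → con 1ℚ :* con 0ℚ := (con 0ℚ :- con 0ℚ :* l) :* (con 1ℚ :* con 1ℚ)) refl lam
    where open +-*-Solver
  orderedStirling2λ-suc-zero (suc m) = trans (*-zeroʳ (ofℕ (suc (suc m) !))) (sym (trans
    (cong (y *_) (*-zeroʳ (ofℕ (suc m !)))) (*-zeroʳ y)))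
    where y = ofℕ 0 - ofℕ (suc m) * lam

  orderedStirling2λ-suc-suc : ∀ m k → orderedStirling2λ lam (suc m) (suc k)
                                       ≡ ofℕ (suc k) * orderedStirling2λ lam m k
                                         + (ofℕ (suc k) - ofℕ m * lam) * orderedStirling2λ lam m (suc k)
  orderedStirling2λ-suc-suc m k = begin
    ofℕ (suc m !) * P (suc m)
      ≡⟨ cong (_* P (suc m)) (ofℕ-* (suc m) (m !)) ⟩
    N * F * P (suc m)
      ≡⟨ solve 6 (λ N F P₁ l M P₀ → N :* F :* P₁ := F :* (N :* P₁ :+ l :* (M :* P₀)) :- F :* l :* M :* P₀)
                 refl N F (P (suc m)) lam M (P m) ⟩
    F * (N * P (suc m) + lam * (M * P m)) - F * lam * M * P m
      ≡⟨ cong (λ z → F * z - F * lam * M * P m) coefficient-m ⟩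
    F * (K * (powS u k m + P m)) - F * lam * M * P m
      ≡⟨ solve 6 (λ F K U P₀ l M → F :* (K :* (U :+ P₀)) :- F :* l :* M :* P₀
                                    := K :* (F :* U) :+ (K :- M :* l) :* (F :* P₀))
                 refl F K (powS u k m) (P m) lam M ⟩
    K * orderedStirling2λ lam m k + (K - M * lam) * orderedStirling2λ lam m (suc k) ∎
    where
    open +-*-Solver
    P = powS u (suc k)
    N = ofℕ (suc m)
    M = ofℕ m
    F = ofℕ (m !)
    K = ofℕ (suc k)
    coefficient-m : N * P (suc m) + lam * (M * P m) ≡ K * (powS u k m + P m)
    coefficient-m = trans (sym (eλ^-λ-⊛-∂ lam P m))
                   (trans (eλ^-λ-⊛-∂-powS k m) (constS-⊛ K (powS u k ⊕ P) m))

module _ (lam t : ℚ) where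

  private
    u : Series
    u = minusOneS (eλ lam)

    G : Series
    G = geomS (scaleS t u)

    y : ℕ → ℕ → ℚ
    y m k = ofℕ k - ofℕ m * lam

    W : ℕ → ℕ → Series
    W m k = powS G (suc k) ⊛ eλ^ lam (y m k)

  fubiniλ-geomS : ∀ N → fubiniλ lam N t ≡ ofℕ (N !) * G N
  fubiniλ-geomS N = begin
    sumTo N (λ k → ofℕ (k !) * stirling2λ lam N k * t ^ℚ k)  ≡⟨ sumTo-cong N term ⟩
    sumTo N (λ k → ofℕ (N !) * powS (scaleS t u) k N)       ≡⟨ sumTo-*ˡ N (ofℕ (N !)) _ ⟨
    ofℕ (N !) * G N                                         ∎
    where
    open +-*-Solver
    term : ∀ k → ofℕ (k !) * stirling2λ lam N k * t ^ℚ k ≡ ofℕ (N !) * powS (scaleS t u) k N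
    term k = begin
      ofℕ (k !) * stirling2λ lam N k * t ^ℚ k
        ≡⟨ cong (_* t ^ℚ k) (ofℕ-!-*-stirling2λ lam N k) ⟩
      ofℕ (N !) * powS u k N * t ^ℚ k
        ≡⟨ solve 3 (λ f p c → f :* p :* c := f :* (c :* p)) refl (ofℕ (N !)) (powS u k N) (t ^ℚ k) ⟩
      ofℕ (N !) * (t ^ℚ k * powS u k N)
        ≡⟨ cong (ofℕ (N !) *_) (powS-scaleS t u k N) ⟨
      ofℕ (N !) * powS (scaleS t u) k N ∎

  ∂-G : ∂ G ≈ (((constS t ⊛ eλ^ lam (1ℚ - lam)) ⊛ G) ⊛ G)
  ∂-G = ≈-trans (∂-geomS (scaleS t u) (*-zeroʳ t)) (⊛-cong (⊛-cong ∂v (≈-refl {G})) (≈-refl {G}))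
    where
    open +-*-Solver
    ∂v : ∂ (scaleS t u) ≈ (constS t ⊛ eλ^ lam (1ℚ - lam))
    ∂v n = begin
      ofℕ (suc n) * (t * u (suc n))
        ≡⟨ solve 3 (λ a b c → a :* (b :* c) := b :* (a :* c)) refl (ofℕ (suc n)) t (u (suc n)) ⟩
      t * ∂ (eλ lam) n
        ≡⟨ cong (t *_) (∂-eλ lam n) ⟩
      t * eλ^ lam (1ℚ - lam) n
        ≡⟨ constS-⊛ t (eλ^ lam (1ℚ - lam)) n ⟨
      (constS t ⊛ eλ^ lam (1ℚ - lam)) n ∎

  ∂-powS-G : ∀ k → ∂ (powS G (suc k))
                    ≈ (constS (ofℕ (suc k) * t) ⊛ (powS G (suc (suc k)) ⊛ eλ^ lam (1ℚ - lam)))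
  ∂-powS-G k n = begin
    ∂ (powS G (suc k)) n
      ≡⟨ ∂-powS G k n ⟩
    (K ⊛ (powS G k ⊛ ∂ G)) n
      ≡⟨ ⊛-cong (≈-refl {K}) (⊛-cong (≈-refl {powS G k}) ∂-G) n ⟩
    (K ⊛ (powS G k ⊛ (((T ⊛ E) ⊛ G) ⊛ G))) n
      ≡⟨ S.solve 5 (λ K P g T E → K ⊠ (P ⊠ (((T ⊠ E) ⊠ g) ⊠ g)) ≐ (K ⊠ T) ⊠ ((g ⊠ (g ⊠ P)) ⊠ E))
                 (λ _ → refl) K (powS G k) G T E n ⟩
    ((K ⊛ T) ⊛ (powS G (suc (suc k)) ⊛ E)) n
      ≡⟨ ⊛-cong (≈-sym (constS-* (ofℕ (suc k)) t)) (≈-refl {powS G (suc (suc k)) ⊛ E}) n ⟩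
    (constS (ofℕ (suc k) * t) ⊛ (powS G (suc (suc k)) ⊛ E)) n ∎
    where
    K = constS (ofℕ (suc k))
    T = constS t
    E = eλ^ lam (1ℚ - lam)

  ∂-W : ∀ m k n → ∂ (W m k) n ≡ ofℕ (suc k) * t * W (suc m) (suc k) n + y m k * W (suc m) k n
  ∂-W m k n = begin
    ∂ (P ⊛ E) n
      ≡⟨ ∂-⊛ P E n ⟩
    ((∂ P ⊛ E) ⊕ (P ⊛ ∂ E)) n
      ≡⟨ ⊕-cong (⊛-cong (∂-powS-G k) (≈-refl {E})) (⊛-cong (≈-refl {P}) (∂-eλ^ lam (y m k))) n ⟩
    (((Kt ⊛ (P₂ ⊛ E₁)) ⊛ E) ⊕ (P ⊛ (Y ⊛ E₂))) n
      ≡⟨ S.solve 7 (λ Kt P₂ E₁ E P Y E₂ → (Kt ⊠ (P₂ ⊠ E₁)) ⊠ E ⊞ P ⊠ (Y ⊠ E₂) ≐ Kt ⊠ (P₂ ⊠ (E₁ ⊠ E)) ⊞ Y ⊠ (P ⊠ E₂))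
                 (λ _ → refl) Kt P₂ E₁ E P Y E₂ n ⟩
    ((Kt ⊛ (P₂ ⊛ (E₁ ⊛ E))) ⊕ (Y ⊛ (P ⊛ E₂))) n
      ≡⟨ ⊕-cong (⊛-cong (≈-refl {Kt}) (⊛-cong (≈-refl {P₂}) (≈-trans (eλ^-+ lam (1ℚ - lam) (y m k)) (e-cong y-suc-suc))))
                (⊛-cong (≈-refl {Y}) (⊛-cong (≈-refl {P}) (e-cong y-suc))) n ⟩
    ((Kt ⊛ W (suc m) (suc k)) ⊕ (Y ⊛ W (suc m) k)) n
      ≡⟨ cong₂ _+_ (constS-⊛ (ofℕ (suc k) * t) (W (suc m) (suc k)) n) (constS-⊛ (y m k) (W (suc m) k) n) ⟩
    ofℕ (suc k) * t * W (suc m) (suc k) n + y m k * W (suc m) k n ∎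
    where
    open +-*-Solver
    e = eλ^ lam
    P = powS G (suc k)
    P₂ = powS G (suc (suc k))
    E = e (y m k)
    E₁ = e (1ℚ - lam)
    E₂ = e (y m k - lam)
    Kt = constS (ofℕ (suc k) * t)
    Y = constS (y m k)
    e-cong : ∀ {a b} → a ≡ b → e a ≈ e b
    e-cong a≡b i = cong (λ x → e x i) a≡b
    y-suc-suc : (1ℚ - lam) + y m k ≡ y (suc m) (suc k)
    y-suc-suc = trans (solve 3 (λ l a b → (con 1ℚ :- l) :+ (a :- b :* l) := (con 1ℚ :+ a) :- (con 1ℚ :+ b) :* l)
                               refl lam (ofℕ k) (ofℕ m))
                      (sym (cong₂ (λ a b → a - b * lam) (ofℕ-suc k) (ofℕ-suc m)))
    y-suc : y m k - lam ≡ y (suc m) k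
    y-suc = trans (solve 3 (λ l a b → (a :- b :* l) :- l := a :- (con 1ℚ :+ b) :* l) refl lam (ofℕ k) (ofℕ m))
                  (sym (cong (λ b → ofℕ k - b * lam) (ofℕ-suc m)))

  ∂^-G : ∀ m n → ∂^ m G n ≡ sumTo m (λ k → orderedStirling2λ lam m k * t ^ℚ k * W m k n)
  ∂^-G zero n = sym (begin
    1ℚ * 1ℚ * 1ℚ * ((G ⊛ oneS) ⊛ eλ^ lam (y 0 0)) n
      ≡⟨ *-identityˡ _ ⟩
    ((G ⊛ oneS) ⊛ eλ^ lam (y 0 0)) n
      ≡⟨ ⊛-cong (≈-refl {G ⊛ oneS}) (≈-trans (λ i → cong (λ x → eλ^ lam x i) y00≡0) (eλ^-0 lam)) n ⟩
    ((G ⊛ oneS) ⊛ oneS) n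
      ≡⟨ S.solve 1 (λ g → g ⊠ ĉ 1 ⊠ ĉ 1 ≐ g) (λ _ → refl) G n ⟩
    G n ∎)
    where
    y00≡0 : y 0 0 ≡ 0ℚ
    y00≡0 = solve 1 (λ l → con 0ℚ :- con 0ℚ :* l := con 0ℚ) refl lam
      where open +-*-Solver
  ∂^-G (suc m) n = begin
    ofℕ (suc n) * ∂^ m G (suc n)
      ≡⟨ cong (ofℕ (suc n) *_) (∂^-G m (suc n)) ⟩
    ofℕ (suc n) * sumTo m (λ k → c m k * t ^ℚ k * W m k (suc n))
      ≡⟨ sumTo-*ˡ m (ofℕ (suc n)) _ ⟩
    sumTo m (λ k → ofℕ (suc n) * (c m k * t ^ℚ k * W m k (suc n)))
      ≡⟨ sumTo-cong m differentiate-term ⟩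
    sumTo m (λ k → p k + q k)
      ≡⟨ sumTo-+ m p q ⟩
    sumTo m p + sumTo m q
      ≡⟨ sumTo-pascal m b p q b0≡q0 b≡p+q q[1+m]≡0 ⟨
    sumTo (suc m) b ∎
    where
    open +-*-Solver
    c = orderedStirling2λ lam
    b p q : ℕ → ℚ
    b k = c (suc m) k * t ^ℚ k * W (suc m) k n
    p k = ofℕ (suc k) * c m k * t ^ℚ suc k * W (suc m) (suc k) n
    q k = y m k * c m k * t ^ℚ k * W (suc m) k n
    differentiate-term : ∀ k → ofℕ (suc n) * (c m k * t ^ℚ k * W m k (suc n)) ≡ p k + q k
    differentiate-term k = begin
      ofℕ (suc n) * (c m k * t ^ℚ k * W m k (suc n))
        ≡⟨ solve 3 (λ N a w → N :* (a :* w) := a :* (N :* w))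
                   refl (ofℕ (suc n)) (c m k * t ^ℚ k) (W m k (suc n)) ⟩
      c m k * t ^ℚ k * ∂ (W m k) n
        ≡⟨ cong (c m k * t ^ℚ k *_) (∂-W m k n) ⟩
      c m k * t ^ℚ k * (ofℕ (suc k) * t * W (suc m) (suc k) n + y m k * W (suc m) k n)
        ≡⟨ solve 7 (λ ck tk K t w₁ Y w₀ → ck :* tk :* (K :* t :* w₁ :+ Y :* w₀)
                                          := K :* ck :* (t :* tk) :* w₁ :+ Y :* ck :* tk :* w₀) refl
                 (c m k) (t ^ℚ k) (ofℕ (suc k)) t (W (suc m) (suc k) n) (y m k) (W (suc m) k n) ⟩
      p k + q k ∎
    b0≡q0 : b 0 ≡ q 0
    b0≡q0 = cong (λ s → s * t ^ℚ 0 * W (suc m) 0 n) (orderedStirling2λ-suc-zero lam m)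
    b≡p+q : ∀ k → b (suc k) ≡ p k + q (suc k)
    b≡p+q k = trans (cong (λ s → s * t ^ℚ suc k * W (suc m) (suc k) n) (orderedStirling2λ-suc-suc lam m k))
                    (solve 4 (λ x y z w → (x :+ y) :* z :* w := x :* z :* w :+ y :* z :* w) refl
                           (ofℕ (suc k) * c m k) (y m (suc k) * c m (suc k)) (t ^ℚ suc k) (W (suc m) (suc k) n))
    q[1+m]≡0 : q (suc m) ≡ 0ℚ
    q[1+m]≡0 = begin
      y m (suc m) * c m (suc m) * t ^ℚ suc m * W (suc m) (suc m) n
        ≡⟨ cong (λ s → y m (suc m) * s * t ^ℚ suc m * W (suc m) (suc m) n)
                (orderedStirling2λ-vanish lam {m} ℕ.≤-refl) ⟩
      y m (suc m) * 0ℚ * t ^ℚ suc m * W (suc m) (suc m) n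
        ≡⟨ solve 3 (λ a b c → a :* con 0ℚ :* b :* c := con 0ℚ)
                   refl (y m (suc m)) (t ^ℚ suc m) (W (suc m) (suc m) n) ⟩
      0ℚ ∎

  !-*-W : ∀ m k n → ofℕ (n !) * W m k n
                    ≡ sumTo n (λ l → ofℕ (n C l) * fubiniλ lam l t * fubini2λ lam k (n ∸ l) t (y m k))
  !-*-W m k n = begin
    ofℕ (n !) * ((G ⊛ powS G k) ⊛ eλ^ lam (y m k)) n
      ≡⟨ cong (ofℕ (n !) *_) (⊛-assoc G (powS G k) (eλ^ lam (y m k)) n) ⟩
    ofℕ (n !) * (G ⊛ (powS G k ⊛ eλ^ lam (y m k))) n
      ≡⟨ !-*-⊛ G (powS G k ⊛ eλ^ lam (y m k)) n ⟩
    sumTo n (λ l → ofℕ (n C l) * (ofℕ (l !) * G l) * fubini2λ lam k (n ∸ l) t (y m k))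
      ≡⟨ sumTo-cong n (λ l → cong (λ F → ofℕ (n C l) * F * fubini2λ lam k (n ∸ l) t (y m k))
                                  (fubiniλ-geomS l)) ⟨
    sumTo n (λ l → ofℕ (n C l) * fubiniλ lam l t * fubini2λ lam k (n ∸ l) t (y m k)) ∎

  fubiniλ-+ : ∀ m n → fubiniλ lam (n ℕ.+ m) t
              ≡ sumTo m (λ k → orderedStirling2λ lam m k * t ^ℚ k
                             * sumTo n (λ l → ofℕ (n C l) * fubiniλ lam l t * fubini2λ lam k (n ∸ l) t (y m k)))
  fubiniλ-+ m n = begin
    fubiniλ lam (n ℕ.+ m) t
      ≡⟨ fubiniλ-geomS (n ℕ.+ m) ⟩
    ofℕ ((n ℕ.+ m) !) * G (n ℕ.+ m)
      ≡⟨ ∂^-coefficient m n G ⟨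
    ofℕ (n !) * ∂^ m G n
      ≡⟨ cong (ofℕ (n !) *_) (∂^-G m n) ⟩
    ofℕ (n !) * sumTo m (λ k → a k * W m k n)
      ≡⟨ sumTo-*ˡ m (ofℕ (n !)) _ ⟩
    sumTo m (λ k → ofℕ (n !) * (a k * W m k n))
      ≡⟨ sumTo-cong m (λ k → trans (*-swapˡ (ofℕ (n !)) (a k) _) (cong (a k *_) (!-*-W m k n))) ⟩
    sumTo m (λ k → a k * sumTo n (λ l → ofℕ (n C l) * fubiniλ lam l t * fubini2λ lam k (n ∸ l) t (y m k))) ∎
    where
    open +-*-Solver
    a : ℕ → ℚ
    a k = orderedStirling2λ lam m k * t ^ℚ k
    *-swapˡ : ∀ x y z → x * (y * z) ≡ y * (x * z)
    *-swapˡ = solve 3 (λ x y z → x :* (y :* z) := y :* (x :* z)) refl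

theorem3 : (lam : ℚ) → lam ≢ 0ℚ → (t : ℚ) → (m n : ℕ) →
    fubiniλ lam (n Data.Nat.+ m) t
      ≡ sumTo m (λ k → sumTo n (λ l →
          ofℕ (k !) * stirling2λ lam m k * ofℕ (n C l) * (t ^ℚ k)
            * fubini2λ lam k (n ∸ l) t (ofℕ k - ofℕ m * lam)
            * fubiniλ lam l t))
theorem3 lam _ t m n = begin
  fubiniλ lam (n ℕ.+ m) t
    ≡⟨ fubiniλ-+ lam t m n ⟩
  sumTo m (λ k → orderedStirling2λ lam m k * t ^ℚ k * sumTo n (λ l → ofℕ (n C l) * F l * F₂ k l))
    ≡⟨ sumTo-cong m (λ k → sumTo-*ˡ n (orderedStirling2λ lam m k * t ^ℚ k) _) ⟩
  sumTo m (λ k → sumTo n (λ l → orderedStirling2λ lam m k * t ^ℚ k * (ofℕ (n C l) * F l * F₂ k l)))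
    ≡⟨ sumTo-cong m (λ k → sumTo-cong n (λ l → reorder k l)) ⟩
  sumTo m (λ k → sumTo n (λ l → ofℕ (k !) * stirling2λ lam m k * ofℕ (n C l) * t ^ℚ k * F₂ k l * F l)) ∎
  where
  open +-*-Solver
  F : ℕ → ℚ
  F l = fubiniλ lam l t
  F₂ : ℕ → ℕ → ℚ
  F₂ k l = fubini2λ lam k (n ∸ l) t (ofℕ k - ofℕ m * lam)
  reorder : ∀ k l → orderedStirling2λ lam m k * t ^ℚ k * (ofℕ (n C l) * F l * F₂ k l)
                    ≡ ofℕ (k !) * stirling2λ lam m k * ofℕ (n C l) * t ^ℚ k * F₂ k l * F l
  reorder k l = begin
    orderedStirling2λ lam m k * t ^ℚ k * (ofℕ (n C l) * F l * F₂ k l)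
      ≡⟨ cong (λ s → s * t ^ℚ k * (ofℕ (n C l) * F l * F₂ k l)) (ofℕ-!-*-stirling2λ lam m k) ⟨
    ofℕ (k !) * stirling2λ lam m k * t ^ℚ k * (ofℕ (n C l) * F l * F₂ k l)
      ≡⟨ solve 5 (λ s x c f g → s :* x :* (c :* f :* g) := s :* c :* x :* g :* f) refl
               (ofℕ (k !) * stirling2λ lam m k) (t ^ℚ k) (ofℕ (n C l)) (F l) (F₂ k l) ⟩
    ofℕ (k !) * stirling2λ lam m k * ofℕ (n C l) * t ^ℚ k * F₂ k l * F l ∎
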